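{- For all integers $n \geq m \geq 2$, let $P_m$ and $P_n$ be the paths on $m$ and $n$ vertices. Then \[ \gamma_{1/2}(P_m \square P_n) \geq \gamma_{1/2}(P_m)\,\gamma_{1/2}(P_n). \]
   Context: For a graph $G=(V,E)$ and a vertex $v$, $N[v]$ denotes the closed neighborhood of $v$ (its neighbors together with $v$), and for $S\subseteq V$, $N[S]=\bigcup_{u\in S}N[u]$. For $p\in[0,1]$, a set $S\subseteq V$ is a $p$-dominating set if $|N[S]|/|V|\geq p$; the $p$-domination number $\gamma_p(G)$ is the minimum cardinality of a $p$-dominating set of $G$. $G\square H$ denotes the Cartesian product of graphs $G$ and $H$. -}

module Defs where

open import Data.Nat using (ℕ; zero; suc; _+_; _*_; _≤_; _≡ᵇ_)
open import Data.Bool using (Bool; true; false; _∧_; _∨_; if_then_else_)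
open import Data.Fin using (Fin; toℕ; remQuot)
open import Data.Fin.Subset using (Subset; ∣_∣; _∈_; inside; outside)
open import Data.Vec using (Vec; tabulate; lookup; foldr; zipWith)
open import Data.Product using (Σ; _×_; _,_; proj₁; proj₂)

record Graph : Set where
  field
    order : ℕ
    adj   : Fin order → Fin order → Bool
open Graph public

inS : ∀ {n} → Subset n → Fin n → Bool
inS S i with lookup S i
... | inside  = true
... | outside = false

anyFin : ∀ {n} → (Fin n → Bool) → Bool
anyFin {n} f = foldr (λ _ → Bool) _∨_ false (tabulate f)

_==_ : ∀ {n} → Fin n → Fin n → Bool
i == j = toℕ i ≡ᵇ toℕ j

toSide : Bool → Data.Fin.Subset.Side
toSide true  = inside
toSide false = outside

N[_]ₛ : (G : Graph) → Subset (order G) → Subset (order G)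
N[ G ]ₛ S = tabulate λ u → toSide (anyFin λ w → inS S w ∧ ((w == u) ∨ adj G w u))

-- S is 1/2-dominating: |N[S]| / |V| ≥ 1/2, i.e. |V| ≤ 2 |N[S]|
IsHalfDominating : (G : Graph) → Subset (order G) → Set
IsHalfDominating G S = order G ≤ 2 * ∣ N[ G ]ₛ S ∣

IsHalfDomNumber : Graph → ℕ → Set
IsHalfDomNumber G k =
  (Σ (Subset (order G)) λ S → IsHalfDominating G S × ∣ S ∣ ≡ k)
  × (∀ (S : Subset (order G)) → IsHalfDominating G S → k ≤ ∣ S ∣)
  where open import Relation.Binary.PropositionalEquality using (_≡_)

Path : ℕ → Graph
Path n = record
  { order = n
  ; adj = λ i j → (suc (toℕ i) ≡ᵇ toℕ j) ∨ (suc (toℕ j) ≡ᵇ toℕ i) }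

_□_ : Graph → Graph → Graph
G □ H = record
  { order = order G * order H
  ; adj = λ x y → let (g₁ , h₁) = remQuot (order H) x
                      (g₂ , h₂) = remQuot (order H) y
                  in ((g₁ == g₂) ∧ adj H h₁ h₂) ∨ ((h₁ == h₂) ∧ adj G g₁ g₂) }

-- In the grid Pₘ □ Pₙ every closed neighbourhood has at most 5 vertices, so |N[S]| ≤ 5|S| and a
-- 1/2-dominating set has at least mn/10 vertices. In the path Pₘ the vertices of a single residue
-- class modulo 6 dominate three out of every six consecutive vertices, so γ½(Pₘ) ≤ ⌈m/6⌉ (the
-- class of 1, or of 0 when m ≡ 1 mod 6, where the class of 1 would miss the last vertex).
-- Hence 360 γ½(Pₘ) γ½(Pₙ) ≤ 10 (m+5)(n+5), which is less than 360 + 36mn ≤ 360 (γ½(Pₘ □ Pₙ) + 1)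
-- as soon as m, n ≥ 2.
module Submission where

open import Defs
open import Data.Bool using (Bool; true; false; _∧_; _∨_; T; if_then_else_)
open import Data.Bool.Properties using (T-∧; T-∨; ∧-distribˡ-∨)
open import Data.Empty using (⊥-elim)
open import Data.Fin as Fin using (Fin; toℕ; fromℕ<; remQuot; combine)
import Data.Fin.Properties as Fin
open import Data.Fin.Properties using (toℕ-injective; toℕ-fromℕ<; toℕ<n; combine-remQuot)
open import Data.Fin.Subset using (Subset; ∣_∣; inside; outside)
open import Data.Nat using (ℕ; zero; suc; _+_; _*_; _≤_; _<_; _≡ᵇ_; z≤n; s≤s; s≤s⁻¹; z<s; pred)
open import Data.Nat.Properties
open import Data.Nat.Tactic.RingSolver using (solve-∀)
open import Data.Product using (_×_; _,_; proj₁; proj₂; ∃-syntax)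
open import Data.Sum using (inj₁; inj₂; [_,_]; map₂)
open import Data.Vec using ([]; _∷_; tabulate)
open import Function using (_∘_)
open import Function.Bundles using (Equivalence)
open import Relation.Binary.PropositionalEquality using (_≡_; _≢_; refl; sym; trans; cong; cong₂; subst; module ≡-Reasoning)
open import Relation.Nullary using (¬_; yes; no)

open Equivalence using (to; from)

∨-introˡ : ∀ {x} y → T x → T (x ∨ y)
∨-introˡ y p = T-∨ .from (inj₁ p)

∨-introʳ : ∀ x {y} → T y → T (x ∨ y)
∨-introʳ x p = T-∨ .from (inj₂ p)

≡ᵇ-refl : ∀ x → T (x ≡ᵇ x)
≡ᵇ-refl x = ≡⇒≡ᵇ x x refl

≡ᵇ∧≡ᵇ⇒≡×≡ : ∀ x y z w → T ((x ≡ᵇ y) ∧ (z ≡ᵇ w)) → x ≡ y × z ≡ w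
≡ᵇ∧≡ᵇ⇒≡×≡ x y z w p =
  let p₁ , p₂ = T-∧ .to p in ≡ᵇ⇒≡ x y p₁ , ≡ᵇ⇒≡ z w p₂

count : ∀ {k} → (Fin k → Bool) → ℕ
count {zero}  f = 0
count {suc k} f = (if f Fin.zero then 1 else 0) + count (f ∘ Fin.suc)

∣tabulate∣≡count : ∀ {k} (f : Fin k → Bool) → ∣ tabulate (toSide ∘ f) ∣ ≡ count f
∣tabulate∣≡count {zero}  f = refl
∣tabulate∣≡count {suc k} f with f Fin.zero
... | true  = cong suc (∣tabulate∣≡count (f ∘ Fin.suc))
... | false = ∣tabulate∣≡count (f ∘ Fin.suc)

∣p∣≡count-inS : ∀ {k} (p : Subset k) → ∣ p ∣ ≡ count (inS p)
∣p∣≡count-inS []            = refl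
∣p∣≡count-inS (inside  ∷ p) = cong suc (∣p∣≡count-inS p)
∣p∣≡count-inS (outside ∷ p) = ∣p∣≡count-inS p

inS-tabulate : ∀ {k} (f : Fin k → Bool) i → inS (tabulate (toSide ∘ f)) i ≡ f i
inS-tabulate f Fin.zero with f Fin.zero
... | true  = refl
... | false = refl
inS-tabulate f (Fin.suc i) = inS-tabulate (f ∘ Fin.suc) i

count-cong : ∀ {k} {f g : Fin k → Bool} → (∀ i → f i ≡ g i) → count f ≡ count g
count-cong {zero}  eq = refl
count-cong {suc k} eq = cong₂ _+_ (cong (λ b → if b then 1 else 0) (eq Fin.zero)) (count-cong (eq ∘ Fin.suc))

count-mono : ∀ {k} (f g : Fin k → Bool) → (∀ i → T (f i) → T (g i)) → count f ≤ count g
count-mono {zero}  f g f⇒g = z≤n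
count-mono {suc k} f g f⇒g with f Fin.zero | g Fin.zero | f⇒g Fin.zero
... | true  | true  | _   = s≤s (count-mono (f ∘ Fin.suc) (g ∘ Fin.suc) (f⇒g ∘ Fin.suc))
... | true  | false | f₀⇒g₀ = ⊥-elim (f₀⇒g₀ _)
... | false | true  | _   = m≤n⇒m≤1+n (count-mono (f ∘ Fin.suc) (g ∘ Fin.suc) (f⇒g ∘ Fin.suc))
... | false | false | _   = count-mono (f ∘ Fin.suc) (g ∘ Fin.suc) (f⇒g ∘ Fin.suc)

count-∨ : ∀ {k} (f g : Fin k → Bool) → count (λ i → f i ∨ g i) ≤ count f + count g
count-∨ {zero}  f g = z≤n
count-∨ {suc k} f g with f Fin.zero | g Fin.zero
... | true  | true  = s≤s (≤-trans rest (+-monoʳ-≤ (count (f ∘ Fin.suc)) (n≤1+n _)))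
  where rest = count-∨ (f ∘ Fin.suc) (g ∘ Fin.suc)
... | true  | false = s≤s (count-∨ (f ∘ Fin.suc) (g ∘ Fin.suc))
... | false | true  = ≤-trans (s≤s (count-∨ (f ∘ Fin.suc) (g ∘ Fin.suc)))
                              (≤-reflexive (sym (+-suc (count (f ∘ Fin.suc)) (count (g ∘ Fin.suc)))))
... | false | false = count-∨ (f ∘ Fin.suc) (g ∘ Fin.suc)

count-∨-≤ : ∀ {k} (f g : Fin k → Bool) {a b} → count f ≤ a → count g ≤ b →
            count (λ i → f i ∨ g i) ≤ a + b
count-∨-≤ f g f≤a g≤b = ≤-trans (count-∨ f g) (+-mono-≤ f≤a g≤b)

count-none : ∀ {k} (f : Fin k → Bool) → (∀ i → ¬ T (f i)) → count f ≡ 0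
count-none {zero}  f none = refl
count-none {suc k} f none with f Fin.zero | none Fin.zero
... | true  | f₀≢true = ⊥-elim (f₀≢true _)
... | false | _       = count-none (f ∘ Fin.suc) (none ∘ Fin.suc)

count-unique≤1 : ∀ {k} (f : Fin k → Bool) → (∀ i j → T (f i) → T (f j) → i ≡ j) → count f ≤ 1
count-unique≤1 {zero}  f unique = z≤n
count-unique≤1 {suc k} f unique with f Fin.zero in f₀
... | true  = ≤-reflexive (cong suc (count-none (f ∘ Fin.suc) λ i fᵢ →
                Fin.0≢1+n (unique Fin.zero (Fin.suc i) (subst T (sym f₀) _) fᵢ)))
... | false = count-unique≤1 (f ∘ Fin.suc) λ i j fᵢ fⱼ → Fin.suc-injective (unique (Fin.suc i) (Fin.suc j) fᵢ fⱼ)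

anyFin-intro : ∀ {k} (f : Fin k → Bool) w → T (f w) → T (anyFin f)
anyFin-intro f Fin.zero    p = ∨-introˡ _ p
anyFin-intro f (Fin.suc w) p = ∨-introʳ (f Fin.zero) (anyFin-intro (f ∘ Fin.suc) w p)

count-anyFin≤ : ∀ {k l} (s : Fin k → Bool) (g : Fin k → Fin l → Bool) d →
  (∀ w → count (g w) ≤ d) → count (λ u → anyFin (λ w → s w ∧ g w u)) ≤ d * count s
count-anyFin≤ {zero} {l} s g d g≤d = ≤-reflexive (trans (count-none {l} _ (λ _ ())) (sym (*-zeroʳ d)))
count-anyFin≤ {suc k} {l} s g d g≤d = begin
  count (λ u → (s Fin.zero ∧ g Fin.zero u) ∨ anyFin (λ w → s (Fin.suc w) ∧ g (Fin.suc w) u))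
    ≤⟨ count-∨-≤ {l} _ _ head (count-anyFin≤ (s ∘ Fin.suc) (g ∘ Fin.suc) d (g≤d ∘ Fin.suc)) ⟩
  d * (if s Fin.zero then 1 else 0) + d * count (s ∘ Fin.suc)
    ≡⟨ *-distribˡ-+ d _ _ ⟨
  d * count s ∎
  where
  open ≤-Reasoning
  head : count (λ u → s Fin.zero ∧ g Fin.zero u) ≤ d * (if s Fin.zero then 1 else 0)
  head with s Fin.zero
  ... | true  = ≤-trans (g≤d Fin.zero) (≤-reflexive (sym (*-identityʳ d)))
  ... | false = ≤-reflexive (trans (count-none {l} _ (λ _ ())) (sym (*-zeroʳ d)))

closedNbr : (G : Graph) → Fin (order G) → Fin (order G) → Bool
closedNbr G w u = (w == u) ∨ adj G w u

∈N[S]-intro : ∀ (G : Graph) (S : Subset (order G)) {w u} →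
  T (inS S w) → T (closedNbr G w u) → T (inS (N[ G ]ₛ S) u)
∈N[S]-intro G S {w} {u} w∈S w~u =
  subst T (sym (inS-tabulate _ u)) (anyFin-intro _ w (T-∧ .from (w∈S , w~u)))

∣N[S]∣≤d*∣S∣ : ∀ (G : Graph) d → (∀ w → count (closedNbr G w) ≤ d) →
  ∀ S → ∣ N[ G ]ₛ S ∣ ≤ d * ∣ S ∣
∣N[S]∣≤d*∣S∣ G d nbr≤d S = begin
  ∣ N[ G ]ₛ S ∣                                       ≡⟨ ∣tabulate∣≡count (λ u → anyFin (λ w → inS S w ∧ closedNbr G w u)) ⟩
  count (λ u → anyFin (λ w → inS S w ∧ closedNbr G w u)) ≤⟨ count-anyFin≤ (inS S) (closedNbr G) d nbr≤d ⟩
  d * count (inS S)                                   ≡⟨ cong (d *_) (∣p∣≡count-inS S) ⟨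
  d * ∣ S ∣                                           ∎
  where open ≤-Reasoning

module Grid (m n : ℕ) where

  row col : Fin (m * n) → ℕ
  row u = toℕ (proj₁ (remQuot {m} n u))
  col u = toℕ (proj₂ (remQuot {m} n u))

  row-col-injective : ∀ {u v} → row u ≡ row v → col u ≡ col v → u ≡ v
  row-col-injective {u} {v} r c = trans (sym (combine-remQuot {m} n u))
    (trans (cong₂ combine (toℕ-injective r) (toℕ-injective c)) (combine-remQuot {m} n v))

  count-at≤1 : (F : Fin (m * n) → Bool) (x y : ℕ) →
    (∀ u → T (F u) → row u ≡ x × col u ≡ y) → count F ≤ 1
  count-at≤1 F x y at = count-unique≤1 F λ u v Fu Fv →
    let ru , cu = at u Fu ; rv , cv = at v Fv
    in row-col-injective (trans ru (sym rv)) (trans cu (sym cv))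

  closedNbr≤5 : ∀ w → count (closedNbr (Path m □ Path n) w) ≤ 5
  closedNbr≤5 w = ≤-trans (≤-reflexive (count-cong split))
    (count-∨-≤ isW alongRowOrCol self (count-∨-≤ alongRow alongCol
      (count-∨-≤ isUp isDown up down) (count-∨-≤ isRight isLeft right left)))
    where
    sameRow sameCol isW isUp isDown isRight isLeft alongRow alongCol alongRowOrCol : Fin (m * n) → Bool
    sameRow u = row w ≡ᵇ row u
    sameCol u = col w ≡ᵇ col u
    isW u = w == u
    isUp u = sameRow u ∧ (suc (col w) ≡ᵇ col u)
    isDown u = sameRow u ∧ (suc (col u) ≡ᵇ col w)
    isRight u = sameCol u ∧ (suc (row w) ≡ᵇ row u)
    isLeft u = sameCol u ∧ (suc (row u) ≡ᵇ row w)
    alongRow u = isUp u ∨ isDown u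
    alongCol u = isRight u ∨ isLeft u
    alongRowOrCol u = alongRow u ∨ alongCol u
    split : ∀ u → closedNbr (Path m □ Path n) w u ≡ isW u ∨ alongRowOrCol u
    split u = cong (isW u ∨_) (cong₂ _∨_
      (∧-distribˡ-∨ (sameRow u) (suc (col w) ≡ᵇ col u) (suc (col u) ≡ᵇ col w))
      (∧-distribˡ-∨ (sameCol u) (suc (row w) ≡ᵇ row u) (suc (row u) ≡ᵇ row w)))
    self : count isW ≤ 1
    self = count-unique≤1 isW λ u v w≡u w≡v →
      trans (sym (toℕ-injective {i = w} (≡ᵇ⇒≡ _ _ w≡u))) (toℕ-injective {i = w} (≡ᵇ⇒≡ _ _ w≡v))
    up : count isUp ≤ 1
    up = count-at≤1 isUp (row w) (suc (col w)) λ u p →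
      let r , c = ≡ᵇ∧≡ᵇ⇒≡×≡ (row w) (row u) (suc (col w)) (col u) p in sym r , sym c
    down : count isDown ≤ 1
    down = count-at≤1 isDown (row w) (pred (col w)) λ u p →
      let r , c = ≡ᵇ∧≡ᵇ⇒≡×≡ (row w) (row u) (suc (col u)) (col w) p in sym r , cong pred c
    right : count isRight ≤ 1
    right = count-at≤1 isRight (suc (row w)) (col w) λ u p →
      let c , r = ≡ᵇ∧≡ᵇ⇒≡×≡ (col w) (col u) (suc (row w)) (row u) p in sym r , sym c
    left : count isLeft ≤ 1
    left = count-at≤1 isLeft (pred (row w)) (col w) λ u p →
      let c , r = ≡ᵇ∧≡ᵇ⇒≡×≡ (col w) (col u) (suc (row u)) (row w) p in cong pred r , sym c

  order≤10*γ½ : ∀ {c} → IsHalfDomNumber (Path m □ Path n) c → m * n ≤ 10 * c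
  order≤10*γ½ ((S , dominating , refl) , _) = begin
    m * n                             ≤⟨ dominating ⟩
    2 * ∣ N[ Path m □ Path n ]ₛ S ∣ ≤⟨ *-monoʳ-≤ 2 (∣N[S]∣≤d*∣S∣ (Path m □ Path n) 5 closedNbr≤5 S) ⟩
    2 * (5 * ∣ S ∣)                  ≡⟨ *-assoc 2 5 ∣ S ∣ ⟨
    10 * ∣ S ∣                       ∎
    where open ≤-Reasoning

-- closedNbr (Path m) w u reduces to closedNbrℕ (toℕ w) (toℕ u).
closedNbrℕ : ℕ → ℕ → Bool
closedNbrℕ k u = (k ≡ᵇ u) ∨ ((suc k ≡ᵇ u) ∨ (suc u ≡ᵇ k))

closedNbrℕ-refl : ∀ k → T (closedNbrℕ k k)
closedNbrℕ-refl k = ∨-introˡ _ (≡ᵇ-refl k)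

closedNbrℕ-suc : ∀ k → T (closedNbrℕ k (suc k))
closedNbrℕ-suc k = ∨-introʳ (k ≡ᵇ suc k) (∨-introˡ _ (≡ᵇ-refl k))

closedNbrℕ-pred : ∀ u → T (closedNbrℕ (suc u) u)
closedNbrℕ-pred u = ∨-introʳ (suc u ≡ᵇ u) (∨-introʳ (suc (suc u) ≡ᵇ u) (≡ᵇ-refl u))

DominatedBelow : (ℕ → Bool) → ℕ → ℕ → Set
DominatedBelow t m u = ∃[ k ] k < m × T (t k) × T (closedNbrℕ k u)

Path-halfDominating : ∀ m (t c : ℕ → Bool) →
  (∀ u → u < m → T (c u) → DominatedBelow t m u) →
  m ≤ 2 * count {m} (c ∘ toℕ) → IsHalfDominating (Path m) (tabulate (toSide ∘ t ∘ toℕ))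
Path-halfDominating m t c dominated m≤2c = begin
  m                      ≤⟨ m≤2c ⟩
  2 * count {m} (c ∘ toℕ) ≤⟨ *-monoʳ-≤ 2 (count-mono (c ∘ toℕ) (inS N[S]) c⇒N[S]) ⟩
  2 * count (inS N[S])   ≡⟨ cong (2 *_) (∣p∣≡count-inS N[S]) ⟨
  2 * ∣ N[S] ∣           ∎
  where
  open ≤-Reasoning
  S = tabulate (toSide ∘ t ∘ toℕ)
  N[S] = N[ Path m ]ₛ S
  c⇒N[S] : ∀ u → T (c (toℕ u)) → T (inS N[S] u)
  c⇒N[S] u cu with dominated (toℕ u) (toℕ<n u) cu
  ... | k , k<m , tk , k~u = ∈N[S]-intro (Path m) S
          (subst T (sym (trans (inS-tabulate (t ∘ toℕ) w) (cong t (toℕ-fromℕ< k<m)))) tk)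
          (subst (λ j → T (closedNbrℕ j (toℕ u))) (sym (toℕ-fromℕ< k<m)) k~u)
    where w = fromℕ< k<m

-- Defined by recursion, not as _% 6, so that mod6 (6 + k) reduces to mod6 k.
mod6 : ℕ → ℕ
mod6 0 = 0
mod6 1 = 1
mod6 2 = 2
mod6 3 = 3
mod6 4 = 4
mod6 5 = 5
mod6 (suc (suc (suc (suc (suc (suc k)))))) = mod6 k

mod6[1+k]≡1+x⇒mod6[k]≡x : ∀ k {x} → mod6 (suc k) ≡ suc x → mod6 k ≡ x
mod6[1+k]≡1+x⇒mod6[k]≡x 0 refl = refl
mod6[1+k]≡1+x⇒mod6[k]≡x 1 refl = refl
mod6[1+k]≡1+x⇒mod6[k]≡x 2 refl = refl
mod6[1+k]≡1+x⇒mod6[k]≡x 3 refl = refl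
mod6[1+k]≡1+x⇒mod6[k]≡x 4 refl = refl
mod6[1+k]≡1+x⇒mod6[k]≡x 5 ()
mod6[1+k]≡1+x⇒mod6[k]≡x (suc (suc (suc (suc (suc (suc k)))))) eq = mod6[1+k]≡1+x⇒mod6[k]≡x k eq

inClass : ℕ → ℕ → Bool
inClass s k = mod6 k ≡ᵇ s

nearClass : ℕ → ℕ → Bool
nearClass s u = inClass s u ∨ ((mod6 u ≡ᵇ suc s) ∨ inClass s (suc u))

-- The right neighbour u + 1 is a vertex because m itself is not in the class.
nearClass-dominated : ∀ {s m u} → mod6 m ≢ s → u < m → T (nearClass s u) → DominatedBelow (inClass s) m u
nearClass-dominated {s} {m} {u} m≢s u<m near =
  [ self , [ fromLeft u u<m , fromRight ] ] (map₂ (T-∨ .to) (T-∨ .to near))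
  where
  self : T (inClass s u) → DominatedBelow (inClass s) m u
  self p = u , u<m , p , closedNbrℕ-refl u
  fromLeft : ∀ v → v < m → T (mod6 v ≡ᵇ suc s) → DominatedBelow (inClass s) m v
  fromLeft zero    _     ()
  fromLeft (suc k) 1+k<m p = k , <-trans (n<1+n k) 1+k<m
    , ≡⇒≡ᵇ _ _ (mod6[1+k]≡1+x⇒mod6[k]≡x k (≡ᵇ⇒≡ _ _ p)) , closedNbrℕ-suc k
  fromRight : T (inClass s (suc u)) → DominatedBelow (inClass s) m u
  fromRight p = suc u , ≤∧≢⇒< u<m (λ 1+u≡m → m≢s (trans (cong mod6 (sym 1+u≡m)) (≡ᵇ⇒≡ _ _ p)))
    , p , closedNbrℕ-pred u

Path-γ½≤∣class∣ : ∀ {m a} s → IsHalfDomNumber (Path m) a → mod6 m ≢ s →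
  m ≤ 2 * count {m} (nearClass s ∘ toℕ) → a ≤ count {m} (inClass s ∘ toℕ)
Path-γ½≤∣class∣ {m} s (_ , minimal) m≢s covered = ≤-trans
  (minimal (tabulate (toSide ∘ inClass s ∘ toℕ))
    (Path-halfDominating m (inClass s) (nearClass s) (λ u u<m → nearClass-dominated m≢s u<m) covered))
  (≤-reflexive (∣tabulate∣≡count {m} (inClass s ∘ toℕ)))

6*-suc : ∀ {x k} → 6 * x ≤ k + 5 → 6 * suc x ≤ 6 + k + 5
6*-suc {x} h = ≤-trans (≤-reflexive (*-suc 6 x)) (+-monoʳ-≤ 6 h)

≤2*-3+ : ∀ {x k} → k ≤ 2 * x → 6 + k ≤ 2 * (3 + x)
≤2*-3+ {x} h = ≤-trans (+-monoʳ-≤ 6 h) (≤-reflexive (sym (*-distribˡ-+ 2 3 x)))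

6*∣class0∣≤m+5 : ∀ m → 6 * count {m} (inClass 0 ∘ toℕ) ≤ m + 5
6*∣class0∣≤m+5 0 = ≤ᵇ⇒≤ _ _ _
6*∣class0∣≤m+5 1 = ≤ᵇ⇒≤ _ _ _
6*∣class0∣≤m+5 2 = ≤ᵇ⇒≤ _ _ _
6*∣class0∣≤m+5 3 = ≤ᵇ⇒≤ _ _ _
6*∣class0∣≤m+5 4 = ≤ᵇ⇒≤ _ _ _
6*∣class0∣≤m+5 5 = ≤ᵇ⇒≤ _ _ _
6*∣class0∣≤m+5 (suc (suc (suc (suc (suc (suc k)))))) = 6*-suc (6*∣class0∣≤m+5 k)

6*∣class1∣≤m+5 : ∀ m → 6 * count {m} (inClass 1 ∘ toℕ) ≤ m + 5
6*∣class1∣≤m+5 0 = ≤ᵇ⇒≤ _ _ _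
6*∣class1∣≤m+5 1 = ≤ᵇ⇒≤ _ _ _
6*∣class1∣≤m+5 2 = ≤ᵇ⇒≤ _ _ _
6*∣class1∣≤m+5 3 = ≤ᵇ⇒≤ _ _ _
6*∣class1∣≤m+5 4 = ≤ᵇ⇒≤ _ _ _
6*∣class1∣≤m+5 5 = ≤ᵇ⇒≤ _ _ _
6*∣class1∣≤m+5 (suc (suc (suc (suc (suc (suc k)))))) = 6*-suc (6*∣class1∣≤m+5 k)

m≤2*∣nearClass1∣ : ∀ m → m ≤ 2 * count {m} (nearClass 1 ∘ toℕ)
m≤2*∣nearClass1∣ 0 = ≤ᵇ⇒≤ _ _ _
m≤2*∣nearClass1∣ 1 = ≤ᵇ⇒≤ _ _ _
m≤2*∣nearClass1∣ 2 = ≤ᵇ⇒≤ _ _ _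
m≤2*∣nearClass1∣ 3 = ≤ᵇ⇒≤ _ _ _
m≤2*∣nearClass1∣ 4 = ≤ᵇ⇒≤ _ _ _
m≤2*∣nearClass1∣ 5 = ≤ᵇ⇒≤ _ _ _
m≤2*∣nearClass1∣ (suc (suc (suc (suc (suc (suc k)))))) = ≤2*-3+ (m≤2*∣nearClass1∣ k)

m≤2*∣nearClass0∣ : ∀ m → mod6 m ≡ 1 → m ≤ 2 * count {m} (nearClass 0 ∘ toℕ)
m≤2*∣nearClass0∣ 1 _ = ≤ᵇ⇒≤ _ _ _
m≤2*∣nearClass0∣ (suc (suc (suc (suc (suc (suc k)))))) m≡1 = ≤2*-3+ (m≤2*∣nearClass0∣ k m≡1)

Path-6*γ½≤order+5 : ∀ {m a} → IsHalfDomNumber (Path m) a → 6 * a ≤ m + 5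
Path-6*γ½≤order+5 {m} γ with mod6 m ≟ 1
... | no  m≢1 = ≤-trans (*-monoʳ-≤ 6 (Path-γ½≤∣class∣ 1 γ m≢1 (m≤2*∣nearClass1∣ m))) (6*∣class1∣≤m+5 m)
... | yes m≡1 = ≤-trans (*-monoʳ-≤ 6 (Path-γ½≤∣class∣ 0 γ m≢0 (m≤2*∣nearClass0∣ m m≡1))) (6*∣class0∣≤m+5 m)
  where m≢0 = λ m≡0 → 0≢1+n (trans (sym m≡0) m≡1)

ab≤c-from-bounds : ∀ {m n a b c} → 2 ≤ m → 2 ≤ n →
  6 * a ≤ m + 5 → 6 * b ≤ n + 5 → m * n ≤ 10 * c → a * b ≤ c
ab≤c-from-bounds {suc (suc p)} {suc (suc q)} {a} {b} {c} (s≤s (s≤s _)) (s≤s (s≤s _)) 6a≤m+5 6b≤n+5 mn≤10c =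
  s≤s⁻¹ (*-cancelˡ-< 360 (a * b) (suc c) (begin-strict
    360 * (a * b)                                           ≡⟨ regroup a b ⟩
    10 * ((6 * a) * (6 * b))                                ≤⟨ *-monoʳ-≤ 10 (*-mono-≤ 6a≤m+5 6b≤n+5) ⟩
    10 * ((2 + p + 5) * (2 + q + 5))                        <⟨ m<m+n _ z<s ⟩
    10 * ((2 + p + 5) * (2 + q + 5)) + suc (13 + 2 * p + 2 * q + 26 * (p * q)) ≡⟨ excess p q ⟨
    360 + 36 * ((2 + p) * (2 + q))                          ≤⟨ +-monoʳ-≤ 360 (*-monoʳ-≤ 36 mn≤10c) ⟩
    360 + 36 * (10 * c)                                     ≡⟨ scale c ⟩
    360 * suc c                                             ∎))
  where
  open ≤-Reasoning
  regroup : ∀ a b → 360 * (a * b) ≡ 10 * ((6 * a) * (6 * b))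
  regroup = solve-∀
  excess : ∀ p q → 360 + 36 * ((2 + p) * (2 + q)) ≡
    10 * ((2 + p + 5) * (2 + q + 5)) + suc (13 + 2 * p + 2 * q + 26 * (p * q))
  excess = solve-∀
  scale : ∀ c → 360 + 36 * (10 * c) ≡ 360 * suc c
  scale = solve-∀

mainTheorem1 : ∀ (m n : ℕ) → 2 ≤ m → m ≤ n →
    ∀ (a b c : ℕ) →
    IsHalfDomNumber (Path m) a →
    IsHalfDomNumber (Path n) b →
    IsHalfDomNumber (Path m □ Path n) c →
    a * b ≤ c
mainTheorem1 m n 2≤m m≤n a b c γ½[Pₘ] γ½[Pₙ] γ½[Pₘ□Pₙ] =
  ab≤c-from-bounds {a = a} {b = b} 2≤m (≤-trans 2≤m m≤n)
    (Path-6*γ½≤order+5 γ½[Pₘ]) (Path-6*γ½≤order+5 γ½[Pₙ]) (Grid.order≤10*γ½ m n γ½[Pₘ□Pₙ])
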